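{- Let $m\ge2$, let $G$ be a finite Abelian group and $S=(s_1,\dots,s_n)\in G^n$ with $G\ge[-m+1,m]^*\diamond_2 S$, and write $|G|=2^a q$ with $q$ odd. Then $$m_2(G)\le \frac{|G|}{\sqrt{q\left((m-1)^2\frac{n^2-n}{2}+(m-1)n+1\right)}}-1.$$
   Context: $[a,b]^*=\{a,\dots,b\}\setminus\{0\}$. For a finite Abelian group $G$, finite $M\subseteq\mathbb{Z}\setminus\{0\}$, $t\ge1$ and $S=(s_1,\dots,s_n)\in G^n$: $G\ge M\diamond_t S$ means the elements $\sum_i e_is_i$, for $\mathbf{e}\in(M\cup\{0\})^n$ with $1\le\mathrm{wt}(\mathbf{e})\le t$ (Hamming weight), are nonzero and pairwise distinct for distinct $\mathbf{e}$. $m_2(G)$ is the number of elements of $G$ of order exactly $2$. -}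

module Defs where

open import Level using (Level; _⊔_) renaming (suc to lsuc)
open import Algebra.Bundles using (AbelianGroup)
open import Data.Nat as ℕ using (ℕ; zero; suc; _+_; _*_; _∸_; _^_)
open import Data.Integer as ℤ using (ℤ; +_; -[1+_])
open import Data.Fin using (Fin)
import Data.Fin as Fin
open import Data.Vec using (Vec; []; _∷_; lookup)
open import Data.Vec.Relation.Unary.All using (All)
open import Data.List using (List; length; filter; allFin)
open import Data.Product using (Σ; ∃; _×_; _,_)
open import Relation.Binary.Definitions using (Decidable)
open import Relation.Binary.PropositionalEquality using (_≡_; _≢_)
open import Relation.Nullary using (¬_; Dec; yes; no)
open import Relation.Nullary.Decidable using (_×-dec_; ¬?)

record FiniteAbelianGroup c ℓ : Set (lsuc (c ⊔ ℓ)) where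
  field
    abelianGroup : AbelianGroup c ℓ
  open AbelianGroup abelianGroup public
  field
    _≟_       : Decidable _≈_
    order     : ℕ
    enum      : Fin order → Carrier
    enum-inj  : ∀ i j → enum i ≈ enum j → i ≡ j
    enum-surj : ∀ x → ∃ λ i → enum i ≈ x

module _ {c ℓ} (G : FiniteAbelianGroup c ℓ) where
  open FiniteAbelianGroup G

  card : ℕ
  card = order

  natMul : ℕ → Carrier → Carrier
  natMul zero    x = ε
  natMul (suc k) x = x ∙ natMul k x

  intMul : ℤ → Carrier → Carrier
  intMul (+ k)     x = natMul k x
  intMul -[1+ k ]  x = (natMul (suc k) x) ⁻¹

  linComb : ∀ {n} → Vec ℤ n → Vec Carrier n → Carrier
  linComb []       []       = ε
  linComb (e ∷ es) (s ∷ ss) = intMul e s ∙ linComb es ss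

  HasOrder2 : Carrier → Set ℓ
  HasOrder2 x = (x ≉ ε) × (x ∙ x ≈ ε)

  hasOrder2? : ∀ x → Dec (HasOrder2 x)
  hasOrder2? x = ¬? (x ≟ ε) ×-dec ((x ∙ x) ≟ ε)

  m₂ : ℕ
  m₂ = length (filter (λ i → hasOrder2? (enum i)) (allFin order))

wt : ∀ {n} → Vec ℤ n → ℕ
wt []          = 0
wt (+ zero ∷ es) = wt es
wt (+ suc _ ∷ es) = suc (wt es)
wt (-[1+ _ ] ∷ es) = suc (wt es)

-- e ∈ [-m+1, m]^*  ∪ {0}  =  the integer interval [-m+1, m]  (m ≥ 1)
InRange : ℕ → ℤ → Set
InRange m x = (ℤ.- (+ (m ∸ 1)) ℤ.≤ x) × (x ℤ.≤ + m)

Admissible : ℕ → ℕ → ∀ {n} → Vec ℤ n → Set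
Admissible m t e = All (InRange m) e × (1 ℕ.≤ wt e) × (wt e ℕ.≤ t)

Packing : ∀ {c ℓ} (G : FiniteAbelianGroup c ℓ) (m t : ℕ) {n : ℕ}
          → Vec (FiniteAbelianGroup.Carrier G) n → Set (ℓ)
Packing G m t {n} S =
  (∀ (e : Vec ℤ n) → Admissible m t e → ¬ (linComb G e S ≈ ε))
  × (∀ (e e′ : Vec ℤ n) → Admissible m t e → Admissible m t e′ → e ≢ e′
       → ¬ (linComb G e S ≈ linComb G e′ S))
  where open FiniteAbelianGroup G

-- Let H = {x | x ∙ x ≈ ε}; it is a subgroup with |H| = m₂ + 1. Being an elementary abelian
-- 2-group, H has order a power of 2, and by Lagrange |H| divides |G| = 2^a q, so |H| q ≤ |G|.
-- Let C be the m - 1 nonzero integers c with 2c ∈ [-m+1, m] and V the vectors over C ∪ {0} of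
-- weight at most 2, so that 2|V| = (m-1)²(n²-n) + 2(m-1)n + 2. The map (e , h) ↦ Σ eᵢsᵢ + h on
-- V × H is injective: doubling kills h, and the packing condition separates the doubled vectors
-- 2e. Hence |V| |H| ≤ |G|, and multiplying the two bounds gives the claim.

module Submission where

open import Defs
open import Data.Nat using (ℕ; _+_; _*_; _∸_; _^_; _≤_)
open import Data.Nat.Divisibility using (_∣_)
open import Relation.Nullary using (¬_)
open import Data.Vec using (Vec)
open import Relation.Binary.PropositionalEquality using (_≡_)

open import Level using (Level; _⊔_)
open import Function using (id; _∘_)
open import Data.Empty using (⊥-elim)
open import Data.Unit using (tt)
open import Data.Product using (∃; _×_; _,_; proj₁; proj₂; uncurry)
open import Data.Sum using (_⊎_; inj₁; inj₂; [_,_])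
open import Data.Nat as ℕ using (zero; suc; _<_; z≤n; s≤s; ⌊_/2⌋; ⌈_/2⌉)
open import Data.Nat.Properties
  using ( suc-injective; +-suc; +-identityʳ; +-comm; +-assoc; +-cancelʳ-≡; *-identityˡ; *-zeroʳ
        ; *-assoc; ≤-reflexive; ≤-trans; ≤-antisym; ≤-pred; <-≤-trans; <⇒≢; <⇒≱; n<1+n; m<m+n
        ; n≢0⇒n>0; m≤m*n; m∸n+n≡m; +-monoʳ-≤; +-monoˡ-≤; *-monoˡ-≤; *-monoʳ-≤; *-mono-≤
        ; ^-monoʳ-≤; ⌊n/2⌋+⌈n/2⌉≡n; module ≤-Reasoning)
open import Data.Nat.Divisibility using (_∣0; ∣-refl; ∣-trans; ∣m∣n⇒∣m+n; m∣m*n; *-cancelˡ-∣)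
open import Data.Nat.Tactic.RingSolver using (solve-∀)
open import Data.Integer as ℤ using (ℤ; +_; -[1+_])
import Data.Integer.Properties as ℤ
open import Data.Fin using (Fin; zero; suc; remQuot; combine)
open import Data.Fin.Properties using (injective⇒≤; any?; combine-remQuot)
open import Data.Vec using ([]; _∷_)
import Data.Vec as Vec
import Data.Vec.Properties as Vec
open import Data.Vec.Relation.Unary.All using (All; []; _∷_)
open import Data.List
  using (List; []; _∷_; _++_; map; length; filter; lookup; allFin; applyUpTo; cartesianProductWith)
open import Data.List.Properties
  using ( length-++; length-map; length-applyUpTo; length-tabulate; length-filter
        ; filter-≐; filter-all; filter-none)
import Data.List.Relation.Unary.All as ListAll
import Data.List.Relation.Unary.All.Properties as ListAll
open import Data.List.Relation.Unary.All using ([]; _∷_)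
import Data.List.Relation.Unary.Any as Any
open import Data.List.Relation.Unary.Any.Properties using (lookup-index)
open import Data.List.Relation.Unary.Unique.Propositional using (Unique; []; _∷_)
import Data.List.Relation.Unary.Unique.Propositional.Properties as Unique
open import Data.List.Relation.Binary.Disjoint.Propositional using (Disjoint)
open import Data.List.Membership.Propositional using (_∈_; _∉_)
open import Data.List.Membership.Propositional.Properties
  using ( ∈-lookup; ∈-allFin; ∈-filter⁺; ∈-filter⁻; ∈-map⁻; ∈-++⁻; ∈-applyUpTo⁻
        ; ∈-cartesianProductWith⁻)
open import Relation.Nullary using (Dec; yes; no)
open import Relation.Nullary.Decidable using (decidable-stable)
open import Relation.Unary using (Pred; Decidable; Empty; ∁; _∪_; _∩_; _⊆_; _≐_)
open import Relation.Unary.Properties using (U?; ∁?; _∪?_; _∩?_)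
open import Relation.Binary.Definitions using (_Respects_)
import Relation.Binary.PropositionalEquality as ≡
open import Relation.Binary.PropositionalEquality
  using (_≢_; refl; sym; trans; cong; cong₂; subst; subst₂; module ≡-Reasoning)
import Relation.Binary.Reasoning.Setoid as ≈-Reasoning
import Algebra.Properties.AbelianGroup as AbelianGroupProperties
import Algebra.Properties.CommutativeSemigroup as CommutativeSemigroupProperties

private
  variable
    a p q : Level
    A : Set a

k≤⌊n/2⌋⇒k+k≤n : ∀ {k n} → k ≤ ⌊ n /2⌋ → k + k ≤ n
k≤⌊n/2⌋⇒k+k≤n {zero}                _        = z≤n
k≤⌊n/2⌋⇒k+k≤n {suc k} {suc (suc n)} (s≤s k≤) =
  s≤s (subst (_≤ suc n) (sym (+-suc k k)) (s≤s (k≤⌊n/2⌋⇒k+k≤n k≤)))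

2^i∣2^a*odd⇒i≤a : ∀ {i a q} → ¬ 2 ∣ q → 2 ^ i ∣ 2 ^ a * q → i ≤ a
2^i∣2^a*odd⇒i≤a {zero}                q-odd _ = z≤n
2^i∣2^a*odd⇒i≤a {suc i} {zero}  {q} q-odd 2^[1+i]∣q =
  ⊥-elim (q-odd (∣-trans (m∣m*n (2 ^ i)) (subst (2 ^ suc i ∣_) (*-identityˡ q) 2^[1+i]∣q)))
2^i∣2^a*odd⇒i≤a {suc i} {suc a} {q} q-odd 2^[1+i]∣2^[1+a]*q = s≤s (2^i∣2^a*odd⇒i≤a q-odd
  (*-cancelˡ-∣ 2 (subst (2 ^ suc i ∣_) (*-assoc 2 (2 ^ a) q) 2^[1+i]∣2^[1+a]*q)))

remQuot-injective : ∀ {m n} {i j : Fin (m ℕ.* n)} → remQuot {m} n i ≡ remQuot {m} n j → i ≡ j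
remQuot-injective {m} {n} {i} {j} eq =
  trans (sym (combine-remQuot {m} n i)) (trans (cong (uncurry combine) eq) (combine-remQuot {m} n j))

module _ {P : Pred A p} {Q : Pred A q} (P? : Decidable P) (Q? : Decidable Q) where

  length-filter-∪ : Empty (P ∩ Q) → ∀ xs →
    length (filter (P? ∪? Q?) xs) ≡ length (filter P? xs) + length (filter Q? xs)
  length-filter-∪ disjoint []       = refl
  length-filter-∪ disjoint (x ∷ xs) with P? x | Q? x
  ... | yes px | yes qx = ⊥-elim (disjoint x (px , qx))
  ... | yes _  | no _   = cong suc (length-filter-∪ disjoint xs)
  ... | no _   | yes _  = trans (cong suc (length-filter-∪ disjoint xs)) (sym (+-suc _ _))
  ... | no _   | no _   = length-filter-∪ disjoint xs

length-cartesianProductWith : ∀ {b c} {B : Set b} {C : Set c} (f : A → B → C) xs ys →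
  length (cartesianProductWith f xs ys) ≡ length xs * length ys
length-cartesianProductWith f []       ys = refl
length-cartesianProductWith f (x ∷ xs) ys = trans (length-++ (map (f x) ys))
  (cong₂ _+_ (length-map (f x) ys) (length-cartesianProductWith f xs ys))

lookup-injective : {xs : List A} → Unique xs → ∀ {i j} → lookup xs i ≡ lookup xs j → i ≡ j
lookup-injective (_  ∷ _) {zero}  {zero}  _  = refl
lookup-injective (x∉ ∷ _) {zero}  {suc j} eq = ⊥-elim (ListAll.lookup x∉ (∈-lookup j) eq)
lookup-injective (x∉ ∷ _) {suc i} {zero}  eq = ⊥-elim (ListAll.lookup x∉ (∈-lookup i) (sym eq))
lookup-injective (_  ∷ u) {suc i} {suc j} eq = cong suc (lookup-injective u eq)

injective-∈⇒≤-length : ∀ {k} {xs : List A} (f : Fin k → A) →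
  (∀ {i j} → f i ≡ f j → i ≡ j) → (∀ i → f i ∈ xs) → k ≤ length xs
injective-∈⇒≤-length {xs = xs} f f-injective f∈ = injective⇒≤ {f = Any.index ∘ f∈} λ {i} {j} eq →
  f-injective (trans (lookup-index (f∈ i)) (trans (cong (lookup xs) eq) (sym (lookup-index (f∈ j)))))

-- Coefficient vectors

double : ∀ {n} → Vec ℤ n → Vec ℤ n
double = Vec.map λ x → x ℤ.+ x

double-injective : ∀ {n} {e e′ : Vec ℤ n} → double e ≡ double e′ → e ≡ e′
double-injective {e = []}    {[]}     _  = refl
double-injective {e = x ∷ e} {y ∷ e′} eq = cong₂ _∷_
  (ℤ.*-cancelʳ-≡ x y (+ 2) (trans (x*2≡x+x x) (trans (Vec.∷-injectiveˡ eq) (sym (x*2≡x+x y)))))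
  (double-injective (Vec.∷-injectiveʳ eq))
  where
  x*2≡x+x : ∀ x → x ℤ.* + 2 ≡ x ℤ.+ x
  x*2≡x+x x = trans (ℤ.*-suc x (+ 1)) (cong (ℤ._+_ x) (ℤ.*-identityʳ x))

wt-double : ∀ {n} (e : Vec ℤ n) → wt (double e) ≡ wt e
wt-double []             = refl
wt-double (+ zero  ∷ e)  = wt-double e
wt-double (+ suc _ ∷ e)  = cong suc (wt-double e)
wt-double (-[1+ _ ] ∷ e) = cong suc (wt-double e)

wt≡0⇒≡0 : ∀ {n} (e : Vec ℤ n) → wt e ≡ 0 → e ≡ Vec.replicate n (+ 0)
wt≡0⇒≡0 []           _ = refl
wt≡0⇒≡0 (+ zero ∷ e) w = cong (+ 0 ∷_) (wt≡0⇒≡0 e w)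

wt-∷-nonzero : ∀ {n} c (e : Vec ℤ n) → c ≢ + 0 → wt (c ∷ e) ≡ suc (wt e)
wt-∷-nonzero (+ zero)  e c≢0 = ⊥-elim (c≢0 refl)
wt-∷-nonzero (+ suc _) e _   = refl
wt-∷-nonzero -[1+ _ ]  e _   = refl

sparse : List ℤ → ℕ → (n : ℕ) → List (Vec ℤ n)
sparse C t       zero    = [] ∷ []
sparse C zero    (suc n) = map (+ 0 ∷_) (sparse C zero n)
sparse C (suc t) (suc n) =
  map (+ 0 ∷_) (sparse C (suc t) n) ++ cartesianProductWith _∷_ C (sparse C t n)

Sparse : ∀ {n} → List ℤ → ℕ → Vec ℤ n → Set
Sparse C t e = wt e ≤ t × All (λ x → x ≡ + 0 ⊎ x ∈ C) e

module _ {C : List ℤ} (0∉C : + 0 ∉ C) where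

  private
    0∷-Sparse : ∀ {t n} {e : Vec ℤ n} → Sparse C t e → Sparse C t (+ 0 ∷ e)
    0∷-Sparse (w , entries) = w , inj₁ refl ∷ entries

    c∷-Sparse : ∀ {t n c} {e : Vec ℤ n} → c ∈ C → Sparse C t e → Sparse C (suc t) (c ∷ e)
    c∷-Sparse {t} {c = c} {e} c∈C (w , entries) =
      subst (_≤ suc t) (sym (wt-∷-nonzero c e λ { refl → 0∉C c∈C })) (s≤s w) , inj₂ c∈C ∷ entries

  all-sparse : ∀ t n → ListAll.All (Sparse C t) (sparse C t n)
  all-sparse t       zero    = (z≤n , []) ∷ []
  all-sparse zero    (suc n) = ListAll.map⁺ (ListAll.map 0∷-Sparse (all-sparse zero n))
  all-sparse (suc t) (suc n) = ListAll.++⁺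
    (ListAll.map⁺ (ListAll.map 0∷-Sparse (all-sparse (suc t) n)))
    (ListAll.cartesianProductWith⁺ (≡.setoid ℤ) (≡.setoid (Vec ℤ n)) _∷_ C (sparse C t n)
      λ c∈C e∈ → c∷-Sparse c∈C (ListAll.lookup (all-sparse t n) e∈))

  sparse-unique : Unique C → ∀ t n → Unique (sparse C t n)
  sparse-unique C-unique t       zero    = [] ∷ []
  sparse-unique C-unique zero    (suc n) = Unique.map⁺ Vec.∷-injectiveʳ (sparse-unique C-unique zero n)
  sparse-unique C-unique (suc t) (suc n) = Unique.++⁺
    (Unique.map⁺ Vec.∷-injectiveʳ (sparse-unique C-unique (suc t) n))
    (Unique.cartesianProductWith⁺ _∷_ Vec.∷-injective C-unique (sparse-unique C-unique t n))
    disjoint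
    where
    disjoint : Disjoint (map (+ 0 ∷_) (sparse C (suc t) n)) (cartesianProductWith _∷_ C (sparse C t n))
    disjoint (e∈map , e∈prod) with _ , _ , refl ← ∈-map⁻ (+ 0 ∷_) e∈map
                                 | _ , _ , c∈C , _ , eq ← ∈-cartesianProductWith⁻ _∷_ C (sparse C t n) e∈prod =
      0∉C (subst (_∈ C) (sym (Vec.∷-injectiveˡ eq)) c∈C)

module _ (C : List ℤ) where

  private
    v = length C

  length-sparse-0 : ∀ n → length (sparse C 0 n) ≡ 1
  length-sparse-0 zero    = refl
  length-sparse-0 (suc n) = trans (length-map _ (sparse C 0 n)) (length-sparse-0 n)

  length-sparse-suc : ∀ t n →
    length (sparse C (suc t) (suc n)) ≡ length (sparse C (suc t) n) + v * length (sparse C t n)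
  length-sparse-suc t n = trans (length-++ (map (+ 0 ∷_) (sparse C (suc t) n)))
    (cong₂ _+_ (length-map _ (sparse C (suc t) n)) (length-cartesianProductWith _∷_ C (sparse C t n)))

  length-sparse-1 : ∀ n → length (sparse C 1 n) ≡ 1 + v * n
  length-sparse-1 zero    = cong suc (sym (*-zeroʳ v))
  length-sparse-1 (suc n) = begin
    length (sparse C 1 (suc n))                         ≡⟨ length-sparse-suc 0 n ⟩
    length (sparse C 1 n) + v * length (sparse C 0 n)  ≡⟨ cong₂ (λ x y → x + v * y) (length-sparse-1 n) (length-sparse-0 n) ⟩
    1 + v * n + v * 1                                   ≡⟨ step v n ⟩
    1 + v * suc n                                       ∎
    where
    open ≡-Reasoning
    step : ∀ v n → 1 + v * n + v * 1 ≡ 1 + v * suc n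
    step = solve-∀

  private
    2*length-sparse-2+v*v*n : ∀ n → 2 * length (sparse C 2 n) + v * v * n ≡ v * v * (n * n) + 2 * v * n + 2
    2*length-sparse-2+v*v*n zero    = base v
      where
      base : ∀ v → 2 * 1 + v * v * 0 ≡ v * v * (0 * 0) + 2 * v * 0 + 2
      base = solve-∀
    2*length-sparse-2+v*v*n (suc n) = begin
      2 * length (sparse C 2 (suc n)) + v * v * suc n
        ≡⟨ cong (λ x → 2 * x + v * v * suc n) (length-sparse-suc 1 n) ⟩
      2 * (L₂ + v * length (sparse C 1 n)) + v * v * suc n
        ≡⟨ cong (λ y → 2 * (L₂ + v * y) + v * v * suc n) (length-sparse-1 n) ⟩
      2 * (L₂ + v * (1 + v * n)) + v * v * suc n
        ≡⟨ regroup v n L₂ ⟩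
      (2 * L₂ + v * v * n) + (2 * v + 2 * (v * v * n) + v * v)
        ≡⟨ cong (_+ (2 * v + 2 * (v * v * n) + v * v)) (2*length-sparse-2+v*v*n n) ⟩
      (v * v * (n * n) + 2 * v * n + 2) + (2 * v + 2 * (v * v * n) + v * v)
        ≡⟨ expand v n ⟩
      v * v * (suc n * suc n) + 2 * v * suc n + 2 ∎
      where
      open ≡-Reasoning
      L₂ = length (sparse C 2 n)
      regroup : ∀ v n x → 2 * (x + v * (1 + v * n)) + v * v * suc n
                        ≡ (2 * x + v * v * n) + (2 * v + 2 * (v * v * n) + v * v)
      regroup = solve-∀
      expand : ∀ v n → (v * v * (n * n) + 2 * v * n + 2) + (2 * v + 2 * (v * v * n) + v * v)
                     ≡ v * v * (suc n * suc n) + 2 * v * suc n + 2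
      expand = solve-∀

  length-sparse-2 : ∀ n → 2 * length (sparse C 2 n) ≡ v * v * (n * n ∸ n) + 2 * v * n + 2
  length-sparse-2 n = +-cancelʳ-≡ (v * v * n) _ _ (begin
    2 * length (sparse C 2 n) + v * v * n            ≡⟨ 2*length-sparse-2+v*v*n n ⟩
    v * v * (n * n) + 2 * v * n + 2                  ≡⟨ cong (λ x → v * v * x + 2 * v * n + 2) (m∸n+n≡m (n≤n*n n)) ⟨
    v * v * (n * n ∸ n + n) + 2 * v * n + 2          ≡⟨ distribute v n (n * n ∸ n) ⟩
    v * v * (n * n ∸ n) + 2 * v * n + 2 + v * v * n  ∎)
    where
    open ≡-Reasoning
    n≤n*n : ∀ n → n ≤ n * n
    n≤n*n zero    = z≤n
    n≤n*n (suc n) = m≤m*n (suc n) (suc n)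
    distribute : ∀ v n d → v * v * (d + n) + 2 * v * n + 2 ≡ v * v * d + 2 * v * n + 2 + v * v * n
    distribute = solve-∀

halves : ℕ → List ℤ
halves m = applyUpTo (+_ ∘ suc) ⌊ m /2⌋ ++ applyUpTo -[1+_] ⌊ m ∸ 1 /2⌋

length-halves : ∀ m → length (halves m) ≡ m ∸ 1
length-halves m = trans (length-++ (applyUpTo (+_ ∘ suc) ⌊ m /2⌋))
  (trans (cong₂ _+_ (length-applyUpTo _ ⌊ m /2⌋) (length-applyUpTo _ ⌊ m ∸ 1 /2⌋)) (⌊m/2⌋+⌊m∸1/2⌋ m))
  where
  ⌊m/2⌋+⌊m∸1/2⌋ : ∀ m → ⌊ m /2⌋ + ⌊ m ∸ 1 /2⌋ ≡ m ∸ 1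
  ⌊m/2⌋+⌊m∸1/2⌋ zero    = refl
  ⌊m/2⌋+⌊m∸1/2⌋ (suc m) = trans (+-comm ⌈ m /2⌉ ⌊ m /2⌋) (⌊n/2⌋+⌈n/2⌉≡n m)

halves-unique : ∀ m → Unique (halves m)
halves-unique m = Unique.++⁺
  (Unique.applyUpTo⁺₁ _ ⌊ m /2⌋ λ i<j _ eq → <⇒≢ i<j (suc-injective (ℤ.+-injective eq)))
  (Unique.applyUpTo⁺₁ _ ⌊ m ∸ 1 /2⌋ λ i<j _ eq → <⇒≢ i<j (ℤ.-[1+-injective eq))
  disjoint
  where
  disjoint : Disjoint (applyUpTo (+_ ∘ suc) ⌊ m /2⌋) (applyUpTo -[1+_] ⌊ m ∸ 1 /2⌋)
  disjoint (c∈pos , c∈neg) with ∈-applyUpTo⁻ _ c∈pos | ∈-applyUpTo⁻ _ c∈neg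
  ... | _ , _ , refl | _ , _ , ()

0∉halves : ∀ m → + 0 ∉ halves m
0∉halves m 0∈ with ∈-++⁻ (applyUpTo (+_ ∘ suc) ⌊ m /2⌋) 0∈
... | inj₁ 0∈pos with () ← proj₂ (proj₂ (∈-applyUpTo⁻ _ 0∈pos))
... | inj₂ 0∈neg with () ← proj₂ (proj₂ (∈-applyUpTo⁻ _ 0∈neg))

halves-double : ∀ m {c} → c ∈ halves m → InRange m (c ℤ.+ c)
halves-double m c∈ with ∈-++⁻ (applyUpTo (+_ ∘ suc) ⌊ m /2⌋) c∈
... | inj₁ c∈pos with i , i<⌊m/2⌋ , refl ← ∈-applyUpTo⁻ _ c∈pos =
  ℤ.neg-≤-pos , ℤ.+≤+ (k≤⌊n/2⌋⇒k+k≤n i<⌊m/2⌋)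
... | inj₂ c∈neg with i , i<⌊m∸1/2⌋ , refl ← ∈-applyUpTo⁻ _ c∈neg =
  ℤ.neg-mono-≤ (ℤ.+≤+ (subst (_≤ m ∸ 1) (cong suc (+-suc i i)) (k≤⌊n/2⌋⇒k+k≤n i<⌊m∸1/2⌋))) , ℤ.-≤+

-- Counting in a finite abelian group

module _ {c ℓ} (G : FiniteAbelianGroup c ℓ) where
  open FiniteAbelianGroup G renaming (refl to ≈-refl; sym to ≈-sym; trans to ≈-trans)
  open AbelianGroupProperties abelianGroup
  open CommutativeSemigroupProperties commutativeSemigroup using (interchange; xy∙z≈xz∙y)

  index : Carrier → Fin order
  index x = proj₁ (enum-surj x)

  enum-index : ∀ x → enum (index x) ≈ x
  enum-index x = proj₂ (enum-surj x)

  index-injective : ∀ {x y} → index x ≡ index y → x ≈ y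
  index-injective {x} {y} eq =
    ≈-trans (≈-sym (enum-index x)) (≈-trans (reflexive (cong enum eq)) (enum-index y))

  module _ {P : Pred Carrier p} (P? : Decidable P) where

    elements : List (Fin order)
    elements = filter (P? ∘ enum) (allFin order)

    count : ℕ
    count = length elements

    member : Fin count → Carrier
    member k = enum (lookup elements k)

    member-∈ : ∀ k → P (member k)
    member-∈ k = proj₂ (∈-filter⁻ (P? ∘ enum) {xs = allFin order} (∈-lookup k))

    member-injective : ∀ {k l} → member k ≈ member l → k ≡ l
    member-injective eq =
      lookup-injective (Unique.filter⁺ (P? ∘ enum) (Unique.allFin⁺ order)) (enum-inj _ _ eq)

    count≤order : count ≤ order
    count≤order = ≤-trans (length-filter (P? ∘ enum) (allFin order)) (≤-reflexive (length-tabulate id))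

    injective⇒≤count : P Respects _≈_ → ∀ {k} (f : Fin k → Carrier) →
      (∀ {i j} → f i ≈ f j → i ≡ j) → (∀ i → P (f i)) → k ≤ count
    injective⇒≤count resp f f-injective f∈P =
      injective-∈⇒≤-length (index ∘ f) (f-injective ∘ index-injective)
        (λ i → ∈-filter⁺ (P? ∘ enum) (∈-allFin _) (resp (≈-sym (enum-index (f i))) (f∈P i)))

    count-none : (∀ x → ¬ P x) → count ≡ 0
    count-none none =
      cong length (filter-none (P? ∘ enum) {xs = allFin order} (ListAll.tabulate λ {i} _ → none (enum i)))

    exists? : P Respects _≈_ → Dec (∃ P)
    exists? resp with any? (P? ∘ enum)
    ... | yes (i , Pi) = yes (enum i , Pi)
    ... | no ∄i        = no λ (x , Px) → ∄i (index x , resp (≈-sym (enum-index x)) Px)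

  count-U : count U? ≡ order
  count-U = trans (cong length (filter-all (U? ∘ enum) {xs = allFin order} (ListAll.tabulate λ _ → tt)))
    (length-tabulate id)

  module _ {P : Pred Carrier p} {Q : Pred Carrier q} (P? : Decidable P) (Q? : Decidable Q) where

    count-≐ : P ≐ Q → count P? ≡ count Q?
    count-≐ (P⊆Q , Q⊆P) = cong length (filter-≐ (P? ∘ enum) (Q? ∘ enum) (P⊆Q , Q⊆P) (allFin order))

    count-∪ : Empty (P ∩ Q) → count (P? ∪? Q?) ≡ count P? + count Q?
    count-∪ disjoint = length-filter-∪ (P? ∘ enum) (Q? ∘ enum) (disjoint ∘ enum) (allFin order)

    ⊆-or-∃∖ : P Respects _≈_ → Q Respects _≈_ → P ⊆ Q ⊎ ∃ λ x → P x × ¬ Q x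
    ⊆-or-∃∖ P-resp Q-resp
      with exists? (P? ∩? ∁? Q?) (λ x≈y (Px , ¬Qx) → P-resp x≈y Px , ¬Qx ∘ Q-resp (≈-sym x≈y))
    ... | yes witness = inj₂ witness
    ... | no ∄x       = inj₁ λ {x} Px → decidable-stable (Q? x) λ ¬Qx → ∄x (x , Px , ¬Qx)

  count-∙ʳ-≤ : {P : Pred Carrier p} (P? : Decidable P) → P Respects _≈_ →
    ∀ x → count (λ y → P? (y ∙ x)) ≤ count P?
  count-∙ʳ-≤ P? resp x = injective⇒≤count P? resp (λ k → member P?∙x k ∙ x)
    (λ eq → member-injective P?∙x (∙-cancelʳ x _ _ eq)) (member-∈ P?∙x)
    where P?∙x = λ y → P? (y ∙ x)

  count-∙ʳ : {P : Pred Carrier p} (P? : Decidable P) → P Respects _≈_ →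
    ∀ x → count (λ y → P? (y ∙ x)) ≡ count P?
  count-∙ʳ {P = P} P? resp x = ≤-antisym (count-∙ʳ-≤ P? resp x) (begin
    count P?                        ≡⟨ count-≐ P? (λ y → P? ((y - x) ∙ x)) P≐P[-x∙x] ⟩
    count (λ y → P? ((y - x) ∙ x))  ≤⟨ count-∙ʳ-≤ (λ y → P? (y ∙ x)) (resp ∘ ∙-congʳ) (x ⁻¹) ⟩
    count (λ y → P? (y ∙ x))        ∎)
    where
    open ≤-Reasoning
    P≐P[-x∙x] : P ≐ (λ y → P ((y - x) ∙ x))
    P≐P[-x∙x] = resp (≈-sym (//-rightDividesˡ x _)) , resp (//-rightDividesˡ x _)

  -- Subgroups: Lagrange's theorem and elementary abelian 2-groups

  record IsSubgroup {k} (K : Pred Carrier k) : Set (c ⊔ ℓ ⊔ k) where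
    field
      ∈-resp : K Respects _≈_
      ε-∈    : K ε
      ∙-∈    : ∀ {x y} → K x → K y → K (x ∙ y)
      ⁻¹-∈   : ∀ {x} → K x → K (x ⁻¹)

    -∈-sym : ∀ {x y} → K (x - y) → K (y - x)
    -∈-sym {x} {y} x-y∈K = ∈-resp (⁻¹-anti-homo-// x y) (⁻¹-∈ x-y∈K)

    -∈-trans : ∀ {x y z} → K (x - y) → K (y - z) → K (x - z)
    -∈-trans {x} {y} {z} x-y∈K y-z∈K = ∈-resp x-y∙y-z≈x-z (∙-∈ x-y∈K y-z∈K)
      where
      open ≈-Reasoning setoid
      x-y∙y-z≈x-z : (x - y) ∙ (y - z) ≈ x - z
      x-y∙y-z≈x-z = begin
        (x ∙ y ⁻¹) ∙ (y ∙ z ⁻¹)  ≈⟨ assoc x (y ⁻¹) (y ∙ z ⁻¹) ⟩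
        x ∙ (y ⁻¹ ∙ (y ∙ z ⁻¹))  ≈⟨ ∙-congˡ (\\-leftDividesʳ y (z ⁻¹)) ⟩
        x ∙ z ⁻¹                 ∎

    1≤count : (K? : Decidable K) → 1 ≤ count K?
    1≤count K? = injective⇒≤count K? ∈-resp (λ _ → ε) (λ { {zero} {zero} _ → refl }) (λ _ → ε-∈)

  module _ {k} {K : Pred Carrier k} (K-sub : IsSubgroup K) (K? : Decidable K) where
    open IsSubgroup K-sub

    coset : Carrier → Pred Carrier k
    coset x y = K (y - x)

    coset? : ∀ x → Decidable (coset x)
    coset? x y = K? (y - x)

    CosetClosed : ∀ {a} → Pred Carrier a → Set _
    CosetClosed A = ∀ {x y} → A x → coset x y → A y

    cosetClosed⇒resp : ∀ {a} {A : Pred Carrier a} → CosetClosed A → A Respects _≈_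
    cosetClosed⇒resp closed x≈y Ax = closed Ax (∈-resp (≈-sym (x≈y⇒x∙y⁻¹≈ε (≈-sym x≈y))) ε-∈)

    module _ {a} {A : Pred Carrier a} (A? : Decidable A) (closed : CosetClosed A) {x} (Ax : A x) where

      count-removeCoset : count A? ≡ count (A? ∩? ∁? (coset? x)) + count K?
      count-removeCoset = begin
        count A?                        ≡⟨ count-≐ A? (A∖xK? ∪? coset? x) (split , join) ⟩
        count (A∖xK? ∪? coset? x)       ≡⟨ count-∪ A∖xK? (coset? x) (λ _ ((_ , y∉xK) , y∈xK) → y∉xK y∈xK) ⟩
        count A∖xK? + count (coset? x)  ≡⟨ cong (count A∖xK? ℕ.+_) (count-∙ʳ K? ∈-resp (x ⁻¹)) ⟩
        count A∖xK? + count K?          ∎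
        where
        open ≡-Reasoning
        A∖xK? = A? ∩? ∁? (coset? x)
        split : A ⊆ (A ∩ ∁ (coset x)) ∪ coset x
        split {y} Ay with coset? x y
        ... | yes y∈xK = inj₂ y∈xK
        ... | no y∉xK  = inj₁ (Ay , y∉xK)
        join : (A ∩ ∁ (coset x)) ∪ coset x ⊆ A
        join (inj₁ (Ay , _)) = Ay
        join (inj₂ y∈xK)     = closed Ax y∈xK

      cosetClosed-removeCoset : CosetClosed (A ∩ ∁ (coset x))
      cosetClosed-removeCoset (Ay , y∉xK) z∈yK =
        closed Ay z∈yK , λ z∈xK → y∉xK (-∈-trans (-∈-sym z∈yK) z∈xK)

    private
      count-∣-cosetClosed′ : ∀ fuel {a} {A : Pred Carrier a} (A? : Decidable A) → CosetClosed A →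
        count A? < fuel → count K? ∣ count A?
      count-∣-cosetClosed′ zero       A? closed ()
      count-∣-cosetClosed′ (suc fuel) A? closed count<1+fuel with exists? A? (cosetClosed⇒resp closed)
      ... | no ∄x        = subst (count K? ∣_) (sym (count-none A? λ x Ax → ∄x (x , Ax))) (count K? ∣0)
      ... | yes (x , Ax) = subst (count K? ∣_) (sym count-split)
        (∣m∣n⇒∣m+n (count-∣-cosetClosed′ fuel A∖xK? (cosetClosed-removeCoset A? closed Ax) count<fuel) ∣-refl)
        where
        A∖xK? = A? ∩? ∁? (coset? x)
        count-split = count-removeCoset A? closed Ax
        count<fuel : count A∖xK? < fuel
        count<fuel = <-≤-trans (m<m+n _ (1≤count K?)) (≤-pred (subst (_< suc fuel) count-split count<1+fuel))

    count-∣-cosetClosed : ∀ {a} {A : Pred Carrier a} (A? : Decidable A) → CosetClosed A → count K? ∣ count A?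
    count-∣-cosetClosed A? closed = count-∣-cosetClosed′ (suc (count A?)) A? closed (n<1+n _)

    count-∣-order : count K? ∣ order
    count-∣-order = subst (count K? ∣_) count-U (count-∣-cosetClosed U? λ _ _ → tt)

  isSubgroup-trivial : IsSubgroup (_≈ ε)
  isSubgroup-trivial = record
    { ∈-resp = λ x≈y x≈ε → ≈-trans (≈-sym x≈y) x≈ε
    ; ε-∈    = ≈-refl
    ; ∙-∈    = λ x≈ε y≈ε → ≈-trans (∙-cong x≈ε y≈ε) (identityˡ ε)
    ; ⁻¹-∈   = λ x≈ε → ≈-trans (⁻¹-cong x≈ε) ε⁻¹≈ε
    }

  count-trivial : count (_≟ ε) ≡ 1
  count-trivial = ≤-antisym
    (injective⇒≤ {f = λ (_ : Fin (count (_≟ ε))) → zero {0}} λ {k} {l} _ →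
      member-injective (_≟ ε) (≈-trans (member-∈ (_≟ ε) k) (≈-sym (member-∈ (_≟ ε) l))))
    (IsSubgroup.1≤count isSubgroup-trivial (_≟ ε))

  module _ {k} {L : Pred Carrier k} (L-sub : IsSubgroup L) where
    open IsSubgroup L-sub

    isSubgroup-adjoin : ∀ {b} → b ∙ b ≈ ε → IsSubgroup (λ y → L y ⊎ L (y ∙ b))
    isSubgroup-adjoin {b} b∙b≈ε = record
      { ∈-resp = λ { x≈y (inj₁ Lx)  → inj₁ (∈-resp x≈y Lx)
                   ; x≈y (inj₂ Lxb) → inj₂ (∈-resp (∙-congʳ x≈y) Lxb) }
      ; ε-∈    = inj₁ ε-∈
      ; ∙-∈    = closed
      ; ⁻¹-∈   = λ { (inj₁ Lx)  → inj₁ (⁻¹-∈ Lx)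
                   ; (inj₂ Lxb) → inj₂ (∈-resp (⁻¹[x∙b]≈x⁻¹∙b _) (⁻¹-∈ Lxb)) }
      }
      where
      open ≈-Reasoning setoid
      ⁻¹[x∙b]≈x⁻¹∙b : ∀ x → (x ∙ b) ⁻¹ ≈ x ⁻¹ ∙ b
      ⁻¹[x∙b]≈x⁻¹∙b x = begin
        (x ∙ b) ⁻¹   ≈⟨ ⁻¹-∙-comm x b ⟨
        x ⁻¹ ∙ b ⁻¹  ≈⟨ ∙-congˡ (inverseˡ-unique b b b∙b≈ε) ⟨
        x ⁻¹ ∙ b     ∎
      x∙b∙[y∙b]≈x∙y : ∀ x y → (x ∙ b) ∙ (y ∙ b) ≈ x ∙ y
      x∙b∙[y∙b]≈x∙y x y = begin
        (x ∙ b) ∙ (y ∙ b)  ≈⟨ interchange x b y b ⟩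
        (x ∙ y) ∙ (b ∙ b)  ≈⟨ ∙-congˡ b∙b≈ε ⟩
        (x ∙ y) ∙ ε        ≈⟨ identityʳ (x ∙ y) ⟩
        x ∙ y              ∎
      closed : ∀ {x y} → L x ⊎ L (x ∙ b) → L y ⊎ L (y ∙ b) → L (x ∙ y) ⊎ L ((x ∙ y) ∙ b)
      closed         (inj₁ Lx)  (inj₁ Ly)  = inj₁ (∙-∈ Lx Ly)
      closed {x} {y} (inj₁ Lx)  (inj₂ Lyb) = inj₂ (∈-resp (≈-sym (assoc x y b)) (∙-∈ Lx Lyb))
      closed {x} {y} (inj₂ Lxb) (inj₁ Ly)  = inj₂ (∈-resp (xy∙z≈xz∙y x b y) (∙-∈ Lxb Ly))
      closed {x} {y} (inj₂ Lxb) (inj₂ Lyb) = inj₁ (∈-resp (x∙b∙[y∙b]≈x∙y x y) (∙-∈ Lxb Lyb))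

    count-adjoin : (L? : Decidable L) → ∀ {b} → ¬ L b →
      count (L? ∪? λ y → L? (y ∙ b)) ≡ count L? + count L?
    count-adjoin L? {b} b∉L =
      trans (count-∪ L? (λ y → L? (y ∙ b)) disjoint) (cong (count L? ℕ.+_) (count-∙ʳ L? ∈-resp b))
      where
      disjoint : Empty (L ∩ λ y → L (y ∙ b))
      disjoint y (Ly , Lyb) = b∉L (∈-resp (\\-leftDividesʳ y b) (∙-∈ (⁻¹-∈ Ly) Lyb))

  module _ {k} {K : Pred Carrier k} (K-sub : IsSubgroup K) (K? : Decidable K)
           (K-square : ∀ {x} → K x → x ∙ x ≈ ε) where
    open IsSubgroup K-sub

    private
      -- Each step adjoins some b ∈ K ∖ L, doubling |L|; since |L| ≤ |G| the fuel never runs out.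
      grow : ∀ fuel {l} {L : Pred Carrier l} → IsSubgroup L → (L? : Decidable L) → L ⊆ K →
        ∀ {j} → count L? ≡ 2 ^ j → order < count L? + fuel → ∃ λ i → count K? ≡ 2 ^ i
      grow zero L-sub L? L⊆K count≡2^j order<count+0 =
        ⊥-elim (<⇒≱ (subst (order <_) (+-identityʳ _) order<count+0) (count≤order L?))
      grow (suc fuel) L-sub L? L⊆K {j} count≡2^j order<count+1+fuel
        with ⊆-or-∃∖ K? L? ∈-resp (IsSubgroup.∈-resp L-sub)
      ... | inj₁ K⊆L = j , trans (count-≐ K? L? (K⊆L , L⊆K)) count≡2^j
      ... | inj₂ (b , Kb , b∉L) = grow fuel (isSubgroup-adjoin L-sub (K-square Kb)) (L? ∪? λ y → L? (y ∙ b))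
        [ L⊆K , (λ Lyb → ∈-resp (//-rightDividesʳ b _) (∙-∈ (L⊆K Lyb) (⁻¹-∈ Kb))) ] {suc j}
        (trans count-L′ (cong₂ _+_ count≡2^j (trans count≡2^j (sym (+-identityʳ _)))))
        (subst (λ n → order < n + fuel) (sym count-L′) (begin-strict
          order                             <⟨ order<count+1+fuel ⟩
          count L? + (1 + fuel)             ≤⟨ +-monoʳ-≤ (count L?) (+-monoˡ-≤ fuel (IsSubgroup.1≤count L-sub L?)) ⟩
          count L? + (count L? + fuel)      ≡⟨ +-assoc (count L?) (count L?) fuel ⟨
          (count L? + count L?) + fuel      ∎))
        where
        open ≤-Reasoning
        count-L′ = count-adjoin L-sub L? b∉L

    count≡2^ : ∃ λ i → count K? ≡ 2 ^ i
    count≡2^ = grow order isSubgroup-trivial (_≟ ε) (λ x≈ε → ∈-resp (≈-sym x≈ε) ε-∈) {0} count-trivial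
      (subst (λ n → order < n + order) (sym count-trivial) (n<1+n order))

  TwoTorsion : Pred Carrier ℓ
  TwoTorsion x = x ∙ x ≈ ε

  twoTorsion? : Decidable TwoTorsion
  twoTorsion? x = (x ∙ x) ≟ ε

  isSubgroup-twoTorsion : IsSubgroup TwoTorsion
  isSubgroup-twoTorsion = record
    { ∈-resp = λ x≈y x∙x≈ε → ≈-trans (∙-cong (≈-sym x≈y) (≈-sym x≈y)) x∙x≈ε
    ; ε-∈    = identityˡ ε
    ; ∙-∈    = λ {x} {y} x∙x≈ε y∙y≈ε →
        ≈-trans (interchange x y x y) (≈-trans (∙-cong x∙x≈ε y∙y≈ε) (identityˡ ε))
    ; ⁻¹-∈   = λ {x} x∙x≈ε → ≈-trans (⁻¹-∙-comm x x) (≈-trans (⁻¹-cong x∙x≈ε) ε⁻¹≈ε)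
    }

  m₂+1≡count-twoTorsion : m₂ G + 1 ≡ count twoTorsion?
  m₂+1≡count-twoTorsion = sym (begin
    count twoTorsion?               ≡⟨ count-≐ twoTorsion? (hasOrder2? G ∪? (_≟ ε)) (split , join) ⟩
    count (hasOrder2? G ∪? (_≟ ε))  ≡⟨ count-∪ (hasOrder2? G) (_≟ ε) (λ _ ((x≉ε , _) , x≈ε) → x≉ε x≈ε) ⟩
    m₂ G + count (_≟ ε)             ≡⟨ cong (m₂ G ℕ.+_) count-trivial ⟩
    m₂ G + 1                        ∎)
    where
    open ≡-Reasoning
    open IsSubgroup isSubgroup-twoTorsion
    split : TwoTorsion ⊆ HasOrder2 G ∪ (_≈ ε)
    split {x} x∙x≈ε with x ≟ ε
    ... | yes x≈ε = inj₂ x≈ε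
    ... | no x≉ε  = inj₁ (x≉ε , x∙x≈ε)
    join : HasOrder2 G ∪ (_≈ ε) ⊆ TwoTorsion
    join (inj₁ (_ , x∙x≈ε)) = x∙x≈ε
    join (inj₂ x≈ε)         = ∈-resp (≈-sym x≈ε) ε-∈

  count-twoTorsion*odd≤order : ∀ {a q} → ¬ 2 ∣ q → order ≡ 2 ^ a * q → count twoTorsion? * q ≤ order
  count-twoTorsion*odd≤order {a} {q} q-odd order≡2^a*q
    with i , count≡2^i ← count≡2^ isSubgroup-twoTorsion twoTorsion? id = begin
      count twoTorsion? * q  ≡⟨ cong (_* q) count≡2^i ⟩
      2 ^ i * q              ≤⟨ *-monoˡ-≤ q (^-monoʳ-≤ 2 (2^i∣2^a*odd⇒i≤a {i} {a} q-odd 2^i∣2^a*q)) ⟩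
      2 ^ a * q              ≡⟨ order≡2^a*q ⟨
      order                  ∎
    where
    open ≤-Reasoning
    2^i∣2^a*q : 2 ^ i ∣ 2 ^ a * q
    2^i∣2^a*q = subst₂ _∣_ count≡2^i order≡2^a*q (count-∣-order isSubgroup-twoTorsion twoTorsion?)

  -- Linear combinations and the packing condition

  natMul-+ : ∀ j k x → natMul G (j + k) x ≈ natMul G j x ∙ natMul G k x
  natMul-+ zero    k x = ≈-sym (identityˡ _)
  natMul-+ (suc j) k x = ≈-trans (∙-congˡ (natMul-+ j k x)) (≈-sym (assoc x _ _))

  intMul-double : ∀ i x → intMul G (i ℤ.+ i) x ≈ intMul G i x ∙ intMul G i x
  intMul-double (+ k)    x = natMul-+ k k x
  intMul-double -[1+ k ] x = begin
    natMul G (suc (suc (k + k))) x ⁻¹              ≡⟨ cong (λ j → natMul G (suc j) x ⁻¹) (+-suc k k) ⟨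
    natMul G (suc k + suc k) x ⁻¹                  ≈⟨ ⁻¹-cong (natMul-+ (suc k) (suc k) x) ⟩
    (natMul G (suc k) x ∙ natMul G (suc k) x) ⁻¹   ≈⟨ ⁻¹-∙-comm _ _ ⟨
    natMul G (suc k) x ⁻¹ ∙ natMul G (suc k) x ⁻¹  ∎
    where open ≈-Reasoning setoid

  linComb-double : ∀ {n} (e : Vec ℤ n) S → linComb G (double e) S ≈ linComb G e S ∙ linComb G e S
  linComb-double []      []      = ≈-sym (identityˡ ε)
  linComb-double (i ∷ e) (s ∷ S) =
    ≈-trans (∙-cong (intMul-double i s) (linComb-double e S)) (interchange _ _ _ _)

  linComb-wt≡0 : ∀ {n} (e : Vec ℤ n) S → wt e ≡ 0 → linComb G e S ≈ ε
  linComb-wt≡0 []           []      _ = ≈-refl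
  linComb-wt≡0 (+ zero ∷ e) (s ∷ S) w = ≈-trans (identityˡ _) (linComb-wt≡0 e S w)

  packing-injective : ∀ {m t n} {S : Vec Carrier n} → Packing G m t S →
    ∀ {e e′} → All (InRange m) e → wt e ≤ t → All (InRange m) e′ → wt e′ ≤ t →
    linComb G e S ≈ linComb G e′ S → e ≡ e′
  packing-injective {S = S} (nonzero , distinct) {e} {e′} r w r′ w′ eq with wt e ℕ.≟ 0 | wt e′ ℕ.≟ 0
  ... | yes w≡0 | yes w′≡0 = trans (wt≡0⇒≡0 e w≡0) (sym (wt≡0⇒≡0 e′ w′≡0))
  ... | yes w≡0 | no w′≢0  =
    ⊥-elim (nonzero e′ (r′ , n≢0⇒n>0 w′≢0 , w′) (≈-trans (≈-sym eq) (linComb-wt≡0 e S w≡0)))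
  ... | no w≢0  | yes w′≡0 =
    ⊥-elim (nonzero e (r , n≢0⇒n>0 w≢0 , w) (≈-trans eq (linComb-wt≡0 e′ S w′≡0)))
  ... | no w≢0  | no w′≢0  with Vec.≡-dec ℤ._≟_ e e′
  ...   | yes e≡e′ = e≡e′
  ...   | no e≢e′  = ⊥-elim (distinct e e′ (r , n≢0⇒n>0 w≢0 , w) (r′ , n≢0⇒n>0 w′≢0 , w′) e≢e′ eq)

  square-∙-twoTorsion : ∀ x {s} → TwoTorsion s → (x ∙ s) ∙ (x ∙ s) ≈ x ∙ x
  square-∙-twoTorsion x {s} s∙s≈ε =
    ≈-trans (interchange x s x s) (≈-trans (∙-congˡ s∙s≈ε) (identityʳ (x ∙ x)))

  module _ {m t n} {S : Vec Carrier n} (packing : Packing G m t S)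
           {C : List ℤ} (C-unique : Unique C) (0∉C : + 0 ∉ C)
           (C-double : ∀ {c} → c ∈ C → InRange m (c ℤ.+ c)) where

    private
      V : List (Vec ℤ n)
      V = sparse C t n

      double-inRange : ∀ {n} {e : Vec ℤ n} → All (λ x → x ≡ + 0 ⊎ x ∈ C) e → All (InRange m) (double e)
      double-inRange []                    = []
      double-inRange (inj₁ refl ∷ entries) = (ℤ.neg-≤-pos , ℤ.+≤+ z≤n) ∷ double-inRange entries
      double-inRange (inj₂ c∈C  ∷ entries) = C-double c∈C ∷ double-inRange entries

      double-lookup-inRange : ∀ i → All (InRange m) (double (lookup V i))
      double-lookup-inRange i = double-inRange (proj₂ (ListAll.lookup (all-sparse 0∉C t n) (∈-lookup i)))

      wt-double-lookup≤t : ∀ i → wt (double (lookup V i)) ≤ t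
      wt-double-lookup≤t i = subst (_≤ t) (sym (wt-double (lookup V i)))
        (proj₁ (ListAll.lookup (all-sparse 0∉C t n) (∈-lookup i)))

      translate : Fin (length V) → Fin (count twoTorsion?) → Carrier
      translate i j = linComb G (lookup V i) S ∙ member twoTorsion? j

      translate-injective : ∀ {i i′ j j′} → translate i j ≈ translate i′ j′ → (i , j) ≡ (i′ , j′)
      translate-injective {i} {i′} {j} {j′} eq =
        cong₂ _,_ (lookup-injective (sparse-unique 0∉C C-unique t n) e≡e′)
                  (member-injective twoTorsion? (∙-cancelˡ L _ _ (≈-trans eq (∙-congʳ L′≈L))))
        where
        L  = linComb G (lookup V i) S
        L′ = linComb G (lookup V i′) S
        s  = member twoTorsion? j
        s′ = member twoTorsion? j′
        double-eq : linComb G (double (lookup V i)) S ≈ linComb G (double (lookup V i′)) S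
        double-eq = begin
          linComb G (double (lookup V i)) S   ≈⟨ linComb-double (lookup V i) S ⟩
          L ∙ L                               ≈⟨ square-∙-twoTorsion L (member-∈ twoTorsion? j) ⟨
          (L ∙ s) ∙ (L ∙ s)                   ≈⟨ ∙-cong eq eq ⟩
          (L′ ∙ s′) ∙ (L′ ∙ s′)               ≈⟨ square-∙-twoTorsion L′ (member-∈ twoTorsion? j′) ⟩
          L′ ∙ L′                             ≈⟨ linComb-double (lookup V i′) S ⟨
          linComb G (double (lookup V i′)) S  ∎
          where open ≈-Reasoning setoid
        e≡e′ : lookup V i ≡ lookup V i′
        e≡e′ = double-injective (packing-injective packing
          (double-lookup-inRange i) (wt-double-lookup≤t i) (double-lookup-inRange i′) (wt-double-lookup≤t i′)
          double-eq)
        L′≈L : L′ ≈ L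
        L′≈L = reflexive (cong (λ e → linComb G e S) (sym e≡e′))

    length-sparse*count-twoTorsion≤order : length (sparse C t n) * count twoTorsion? ≤ order
    length-sparse*count-twoTorsion≤order = injective⇒≤ {f = index ∘ uncurry translate ∘ remQuot _}
      (remQuot-injective ∘ translate-injective ∘ index-injective)

lemma10 : ∀ {c ℓ} (G : FiniteAbelianGroup c ℓ) (m n : ℕ) (S : Vec (FiniteAbelianGroup.Carrier G) n)
    → 2 ≤ m → Packing G m 2 S
    → (a q : ℕ) → ¬ (2 ∣ q) → card G ≡ 2 ^ a * q
    → (m₂ G + 1) * (m₂ G + 1) * q * ((m ∸ 1) * (m ∸ 1) * (n * n ∸ n) + 2 * (m ∸ 1) * n + 2)
        ≤ 2 * (card G * card G)
lemma10 G m n S _ packing a q q-odd order≡2^a*q = begin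
  (m₂ G + 1) * (m₂ G + 1) * q * X  ≡⟨ cong (λ x → x * x * q * X) (m₂+1≡count-twoTorsion G) ⟩
  h * h * q * X                    ≡⟨ cong (h * h * q *_) 2*T≡X ⟨
  h * h * q * (2 * T)              ≡⟨ rearrange h q T ⟩
  2 * ((T * h) * (h * q))          ≤⟨ *-monoʳ-≤ 2 (*-mono-≤ T*h≤order h*q≤order) ⟩
  2 * (card G * card G)            ∎
  where
  open ≤-Reasoning
  X = (m ∸ 1) * (m ∸ 1) * (n * n ∸ n) + 2 * (m ∸ 1) * n + 2
  h = count G (twoTorsion? G)
  T = length (sparse (halves m) 2 n)
  2*T≡X : 2 * T ≡ X
  2*T≡X = trans (length-sparse-2 (halves m) n) (cong (λ v → v * v * (n * n ∸ n) + 2 * v * n + 2) (length-halves m))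
  T*h≤order : T * h ≤ card G
  T*h≤order = length-sparse*count-twoTorsion≤order G packing (halves-unique m) (0∉halves m) (halves-double m)
  h*q≤order : h * q ≤ card G
  h*q≤order = count-twoTorsion*odd≤order G {a} q-odd order≡2^a*q
  rearrange : ∀ h q T → h * h * q * (2 * T) ≡ 2 * ((T * h) * (h * q))
  rearrange = solve-∀
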